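{- Let $p$ be a prime, $m\geq0$ an integer, and $U\subseteq\mathbb{Z}_p$ a set with $|u|\leq m$ for all $u\in U$. Then $\Sigma(\{1^m\}\cup U)=\mathbb{Z}_p$ if and only if $\sum_{u\in U}|u|\geq p-m-1$.
   Context: $\mathbb{Z}_p=\mathbb{Z}/p\mathbb{Z}$. For $a\in\mathbb{Z}_p$, $|a|=\min\{|a'|:a'\in\mathbb{Z},\ a'\equiv a\pmod p\}$. $\{1^m\}$ is the multiset consisting of $m$ copies of $1$. $\Sigma(S)$ is the set of all subset sums of a multiset $S$, including the empty sum $0$. -}

module Defs where

open import Data.Nat using (ℕ; _∸_; _⊓_; NonZero)
open import Data.Nat.DivMod using (_mod_)
open import Data.Fin using (Fin; toℕ)
open import Data.List using (List; map; replicate; _++_)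
open import Data.Nat.ListAction using (sum)
open import Data.List.Relation.Binary.Sublist.Propositional using (_⊆_)
open import Data.Product using (∃; _×_)
open import Relation.Binary.PropositionalEquality using (_≡_)

-- Elements of ℤ_p are represented by Fin p (residues 0 … p-1).

-- |a| = min over integer representatives of |a'| = min(a, p - a) for a ∈ {0,…,p-1}.
∣_∣ₚ : ∀ {p} → Fin p → ℕ
∣_∣ₚ {p} a = toℕ a ⊓ (p ∸ toℕ a)

sumₚ : ∀ {p} .{{_ : NonZero p}} → List (Fin p) → Fin p
sumₚ {p} xs = sum (map toℕ xs) mod p

oneₚ : ∀ {p} .{{_ : NonZero p}} → Fin p
oneₚ {p} = 1 mod p

-- x ∈ Σ(S): x is the sum of some sub-multiset of S (empty sub-multiset gives 0).
-- A multiset is represented by a list; sub-multisets are sublists.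
_∈Σ_ : ∀ {p} .{{_ : NonZero p}} → Fin p → List (Fin p) → Set
_∈Σ_ {p} x S = ∃ λ T → T ⊆ S × sumₚ T ≡ x

ΣFull : ∀ {p} .{{_ : NonZero p}} → List (Fin p) → Set
ΣFull {p} S = ∀ (x : Fin p) → x ∈Σ S

-- The multiset {1^m} ∪ U (multiset union, U a set given as a duplicate-free list).
onesWith : ∀ {p} .{{_ : NonZero p}} → ℕ → List (Fin p) → List (Fin p)
onesWith {p} m U = replicate m oneₚ ++ U

module Submission where

-- Every u is either
-- "small" (its residue toℕ u equals |u|) or "large" (toℕ u + |u| = p).  Let the
-- excess E(V) be the total of |u| over the large elements u of a multiset V.  Choosing a large
-- element contributes toℕ u ≡ -|u|, so complementing the choice of every large
-- element turns a sub-multiset T of V into a sub-multiset S of the natural numbers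
-- |V| = (|u|)_{u ∈ V}, and back, with  ΣT + E(V) ≡ ΣS (mod p)  (reflection lemmas).
-- Since x ↦ x + E(V) is a bijection of ℤ_p, Σ(V) = ℤ_p iff the subset sums of |V|
-- in ℕ meet every residue class mod p (full⇔covers).
-- For V = {1^m} ∪ U we have |V| = {1^m} ∪ |U|, and as every |u| ≤ m the subset sums
-- of {1^m} ∪ |U| are exactly the interval [0, m + Σ|U|] (interval lemma).  An
-- interval starting at 0 meets every residue class iff it has at least p elements
-- (covers⇔bound), which is the inequality of the theorem.  Primality of p is only
-- used through p > 1 (so that |1| = 1), and U need not be duplicate-free.

open import Defs
open import Data.Nat using (ℕ; zero; suc; _+_; _*_; _∸_; _%_; _≤_; _<_; _⊓_; pred; z≤n; s≤s; s≤s⁻¹; NonZero; _≤?_; nonTrivial⇒n>1)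
open import Data.Nat.Properties
open import Data.Nat.DivMod using (_mod_; m%n<n; m%n≤m; m%n%n≡m%n; %-distribˡ-+; [m+kn]%n≡m%n; m<n⇒m%n≡m)
open import Data.Nat.Primality using (Prime; prime⇒nonTrivial)
open import Data.Nat.ListAction using (sum)
open import Data.Nat.ListAction.Properties using (sum-++)
open import Data.Fin using (Fin; toℕ)
open import Data.Fin.Properties using (toℕ-fromℕ<; toℕ<n; toℕ-injective)
open import Data.List using (List; []; _∷_; [_]; map; replicate; _++_)
open import Data.List.Properties using (map-++; map-replicate)
open import Data.List.Relation.Binary.Sublist.Propositional using (_⊆_; []; _∷_; _∷ʳ_)
open import Data.List.Relation.Binary.Sublist.Propositional.Properties using (++⁺)
open import Data.List.Relation.Unary.All using (All; []; _∷_)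
import Data.List.Relation.Unary.All.Properties as All
open import Data.List.Relation.Unary.Unique.Propositional using (Unique)
open import Data.Product using (∃; ∃₂; _×_; _,_)
open import Function.Bundles using (_⇔_; mk⇔)
import Function.Properties.Equivalence as ⇔
open import Data.Bool using (if_then_else_)
open import Data.Empty using (⊥-elim)
open import Relation.Nullary using (yes; no; does)
open import Relation.Binary.PropositionalEquality using (_≡_; refl; sym; trans; cong; cong₂; subst; module ≡-Reasoning)
open import Algebra.Properties.CommutativeSemigroup +-commutativeSemigroup using (x∙yz≈y∙xz; interchange)

private variable
  A : Set
  m j k : ℕ

⊆-++⁻ : (xs : List A) {ys zs : List A} → zs ⊆ xs ++ ys →
        ∃₂ λ zs₁ zs₂ → zs ≡ zs₁ ++ zs₂ × zs₁ ⊆ xs × zs₂ ⊆ ys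
⊆-++⁻ []       s          = [] , _ , refl , [] , s
⊆-++⁻ (x ∷ xs) (.x ∷ʳ s)  with ⊆-++⁻ xs s
... | zs₁ , zs₂ , refl , s₁ , s₂ = zs₁ , zs₂ , refl , x ∷ʳ s₁ , s₂
⊆-++⁻ (x ∷ xs) (refl ∷ s) with ⊆-++⁻ xs s
... | zs₁ , zs₂ , refl , s₁ , s₂ = x ∷ zs₁ , zs₂ , refl , refl ∷ s₁ , s₂

replicate-⊆ : {x : A} → j ≤ m → replicate j x ⊆ replicate m x
replicate-⊆ {m = zero}  z≤n     = []
replicate-⊆ {m = suc m} z≤n     = _ ∷ʳ replicate-⊆ {m = m} z≤n
replicate-⊆             (s≤s le) = refl ∷ replicate-⊆ le

sum-⊆ : {xs ys : List ℕ} → xs ⊆ ys → sum xs ≤ sum ys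
sum-⊆ []         = z≤n
sum-⊆ (y ∷ʳ s)   = ≤-trans (sum-⊆ s) (m≤n+m _ y)
sum-⊆ (refl ∷ s) = +-monoʳ-≤ _ (sum-⊆ s)

sum-ones-++ : ∀ m as → sum (replicate m 1 ++ as) ≡ m + sum as
sum-ones-++ zero    as = refl
sum-ones-++ (suc m) as = cong suc (sum-ones-++ m as)

-- The head a is skipped if the rest
-- still reaches k, and taken otherwise (then a ≤ m < k and k ∸ a is reachable).
interval-split : {as : List ℕ} → All (_≤ m) as → k ≤ m + sum as →
                 ∃₂ λ j S → j ≤ m × S ⊆ as × k ≡ j + sum S
interval-split {m} {k} {[]} [] k≤ =
  k , [] , subst (k ≤_) (+-identityʳ m) k≤ , [] , sym (+-identityʳ k)
interval-split {m} {k} {a ∷ as} (a≤m ∷ bounded) k≤ with k ≤? m + sum as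
... | yes k≤rest with interval-split bounded k≤rest
...   | j , S , j≤m , s , eq = j , S , j≤m , a ∷ʳ s , eq
interval-split {m} {k} {a ∷ as} (a≤m ∷ bounded) k≤ | no k≰rest
  with interval-split bounded (m≤n+o⇒m∸n≤o k a (subst (k ≤_) (x∙yz≈y∙xz m a (sum as)) k≤))
... | j , S , j≤m , s , eq = j , a ∷ S , j≤m , refl ∷ s , (begin
    k                ≡⟨ sym (m+[n∸m]≡n a≤k) ⟩
    a + (k ∸ a)      ≡⟨ cong (a +_) eq ⟩
    a + (j + sum S)  ≡⟨ x∙yz≈y∙xz a j (sum S) ⟩
    j + (a + sum S)  ∎)
  where
  open ≡-Reasoning
  a≤k : a ≤ k
  a≤k = ≤-trans a≤m (≤-trans (m≤m+n m (sum as)) (<⇒≤ (≰⇒> k≰rest)))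

interval : {as : List ℕ} → All (_≤ m) as → k ≤ m + sum as →
           ∃ λ S → S ⊆ replicate m 1 ++ as × sum S ≡ k
interval bounded k≤ with interval-split bounded k≤
... | j , S , j≤m , s , eq =
  replicate j 1 ++ S , ++⁺ (replicate-⊆ j≤m) s , trans (sum-ones-++ j S) (sym eq)

module Residues (p : ℕ) .{{_ : NonZero p}} where

  infix 4 _≈_
  _≈_ : ℕ → ℕ → Set
  a ≈ b = a % p ≡ b % p

  %-≈ : ∀ a → a % p ≈ a
  %-≈ a = m%n%n≡m%n a p

  +-cong-≈ : ∀ {a b c d} → a ≈ b → c ≈ d → a + c ≈ b + d
  +-cong-≈ {a} {b} {c} {d} a≈b c≈d = begin
    (a + c) % p              ≡⟨ %-distribˡ-+ a c p ⟩
    (a % p + c % p) % p      ≡⟨ cong₂ (λ x y → (x + y) % p) a≈b c≈d ⟩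
    (b % p + d % p) % p      ≡⟨ sym (%-distribˡ-+ b d p) ⟩
    (b + d) % p              ∎
    where open ≡-Reasoning

  +-multiple-≈ : ∀ a k → a + k * p ≈ a
  +-multiple-≈ a k = [m+kn]%n≡m%n a k p

  +-inverse : ∀ c → c + c * pred p ≡ c * p
  +-inverse c = trans (sym (*-suc c (pred p))) (cong (c *_) (suc-pred p))

  -- Cancellation: add c (p - 1) to both sides.
  +-cancelʳ-≈ : ∀ {a b} c → a + c ≈ b + c → a ≈ b
  +-cancelʳ-≈ {a} {b} c eq = begin
    a % p                          ≡⟨ sym (+-multiple-≈ a c) ⟩
    (a + c * p) % p                ≡⟨ cong (_% p) (regroup a) ⟩
    (a + c + c * pred p) % p       ≡⟨ +-cong-≈ eq refl ⟩
    (b + c + c * pred p) % p       ≡⟨ cong (_% p) (sym (regroup b)) ⟩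
    (b + c * p) % p                ≡⟨ +-multiple-≈ b c ⟩
    b % p                          ∎
    where
    open ≡-Reasoning
    regroup : ∀ a → a + c * p ≡ a + c + c * pred p
    regroup a = trans (cong (a +_) (sym (+-inverse c))) (sym (+-assoc a c _))

  shift-onto : ∀ c r → ∃ λ (x : Fin p) → toℕ x + c ≈ r
  shift-onto c r = (r + c * pred p) mod p , (begin
    (toℕ ((r + c * pred p) mod p) + c) % p  ≡⟨ cong (λ z → (z + c) % p) (toℕ-fromℕ< (m%n<n _ p)) ⟩
    ((r + c * pred p) % p + c) % p          ≡⟨ +-cong-≈ (%-≈ (r + c * pred p)) refl ⟩
    (r + c * pred p + c) % p                ≡⟨ cong (_% p) (regroup r) ⟩
    (r + c * p) % p                         ≡⟨ +-multiple-≈ r c ⟩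
    r % p                                   ∎)
    where
    open ≡-Reasoning
    regroup : ∀ r → r + c * pred p + c ≡ r + c * p
    regroup r = trans (+-assoc r _ c) (cong (r +_) (trans (+-comm _ c) (+-inverse c)))

  ≈⇒≡ : (x y : Fin p) → toℕ x ≈ toℕ y → x ≡ y
  ≈⇒≡ x y eq = toℕ-injective (begin
    toℕ x      ≡⟨ sym (m<n⇒m%n≡m (toℕ<n x)) ⟩
    toℕ x % p  ≡⟨ eq ⟩
    toℕ y % p  ≡⟨ m<n⇒m%n≡m (toℕ<n y) ⟩
    toℕ y      ∎)
    where open ≡-Reasoning

  total : List (Fin p) → ℕ
  total T = sum (map toℕ T)

  total-++ : ∀ T₁ T₂ → total (T₁ ++ T₂) ≡ total T₁ + total T₂
  total-++ T₁ T₂ = trans (cong sum (map-++ toℕ T₁ T₂)) (sum-++ (map toℕ T₁) (map toℕ T₂))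

  sumₚ-≈ : ∀ T → toℕ (sumₚ T) ≈ total T
  sumₚ-≈ T = trans (cong (_% p) (toℕ-fromℕ< (m%n<n (total T) p))) (%-≈ (total T))

  -- u is small when toℕ u ≤ p ∸ toℕ u (then |u| = toℕ u) and large otherwise (then
  -- toℕ u + |u| = p, i.e. toℕ u ≡ -|u|).  The excess of u is |u| if u is large, else 0.
  excess : Fin p → ℕ
  excess u = if does (toℕ u ≤? p ∸ toℕ u) then 0 else ∣ u ∣ₚ

  data Size (u : Fin p) : Set where
    small : ∣ u ∣ₚ ≡ toℕ u → excess u ≡ 0 → Size u
    large : toℕ u + ∣ u ∣ₚ ≡ p → excess u ≡ ∣ u ∣ₚ → Size u

  size : ∀ u → Size u
  size u with toℕ u ≤? p ∸ toℕ u in eq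
  ... | yes u≤ = small (m≤n⇒m⊓n≡m u≤) (cong (λ d → if does d then 0 else ∣ u ∣ₚ) eq)
  ... | no  u≰ = large (begin
      toℕ u + toℕ u ⊓ (p ∸ toℕ u)  ≡⟨ cong (toℕ u +_) (m≥n⇒m⊓n≡n (<⇒≤ (≰⇒> u≰))) ⟩
      toℕ u + (p ∸ toℕ u)          ≡⟨ m+[n∸m]≡n (<⇒≤ (toℕ<n u)) ⟩
      p                            ∎)
    (cong (λ d → if does d then 0 else ∣ u ∣ₚ) eq)
    where open ≡-Reasoning

  -- Reflection on a single element: for small u the choices of u and of |u| agree,
  -- for large u they are complementary, and in all four cases
  -- (residue chosen) + excess u ≡ (absolute value chosen) modulo p.
  small-out : ∀ u → excess u ≡ 0 → total [] + excess u ≈ sum []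
  small-out _ ex = cong (_% p) ex

  small-in : ∀ u → ∣ u ∣ₚ ≡ toℕ u → excess u ≡ 0 → total [ u ] + excess u ≈ sum [ ∣ u ∣ₚ ]
  small-in u ab ex = cong (_% p) (begin
    toℕ u + 0 + excess u  ≡⟨ cong₂ _+_ (cong (_+ 0) (sym ab)) ex ⟩
    ∣ u ∣ₚ + 0 + 0        ≡⟨ +-identityʳ _ ⟩
    ∣ u ∣ₚ + 0            ∎)
    where open ≡-Reasoning

  large-out : ∀ u → excess u ≡ ∣ u ∣ₚ → total [] + excess u ≈ sum [ ∣ u ∣ₚ ]
  large-out _ ex = cong (_% p) (trans ex (sym (+-identityʳ _)))

  large-in : ∀ u → toℕ u + ∣ u ∣ₚ ≡ p → excess u ≡ ∣ u ∣ₚ → total [ u ] + excess u ≈ sum []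
  large-in u tu ex = trans (cong (_% p) (begin
    toℕ u + 0 + excess u  ≡⟨ cong₂ _+_ (+-identityʳ (toℕ u)) ex ⟩
    toℕ u + ∣ u ∣ₚ        ≡⟨ tu ⟩
    p                     ≡⟨ sym (*-identityˡ p) ⟩
    0 + 1 * p             ∎))
    (+-multiple-≈ 0 1)
    where open ≡-Reasoning

  flip⁺ : ∀ u {T} → T ⊆ [ u ] → ∃ λ S → S ⊆ [ ∣ u ∣ₚ ] × total T + excess u ≈ sum S
  flip⁺ u (_ ∷ʳ [])  with size u
  ... | small _  ex = [] , _ ∷ʳ [] , small-out u ex
  ... | large _  ex = _ , refl ∷ [] , large-out u ex
  flip⁺ u (refl ∷ []) with size u
  ... | small ab ex = _ , refl ∷ [] , small-in u ab ex
  ... | large tu ex = [] , _ ∷ʳ [] , large-in u tu ex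

  flip⁻ : ∀ u {S} → S ⊆ [ ∣ u ∣ₚ ] → ∃ λ T → T ⊆ [ u ] × total T + excess u ≈ sum S
  flip⁻ u (_ ∷ʳ [])  with size u
  ... | small _  ex = [] , _ ∷ʳ [] , small-out u ex
  ... | large tu ex = _ , refl ∷ [] , large-in u tu ex
  flip⁻ u (refl ∷ []) with size u
  ... | small ab ex = _ , refl ∷ [] , small-in u ab ex
  ... | large _  ex = [] , _ ∷ʳ [] , large-out u ex

  Excess : List (Fin p) → ℕ
  Excess V = sum (map excess V)

  ≈-++ : ∀ T₁ T₂ S₁ S₂ {e n} → total T₁ + e ≈ sum S₁ → total T₂ + n ≈ sum S₂ →
         total (T₁ ++ T₂) + (e + n) ≈ sum (S₁ ++ S₂)
  ≈-++ T₁ T₂ S₁ S₂ {e} {n} eq₁ eq₂ = begin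
    (total (T₁ ++ T₂) + (e + n)) % p       ≡⟨ cong (λ t → (t + (e + n)) % p) (total-++ T₁ T₂) ⟩
    (total T₁ + total T₂ + (e + n)) % p    ≡⟨ cong (_% p) (interchange (total T₁) (total T₂) e n) ⟩
    (total T₁ + e + (total T₂ + n)) % p    ≡⟨ +-cong-≈ eq₁ eq₂ ⟩
    (sum S₁ + sum S₂) % p                  ≡⟨ cong (_% p) (sym (sum-++ S₁ S₂)) ⟩
    sum (S₁ ++ S₂) % p                     ∎
    where open ≡-Reasoning

  reflect⁺ : ∀ V {T} → T ⊆ V → ∃ λ S → S ⊆ map ∣_∣ₚ V × total T + Excess V ≈ sum S
  reflect⁺ []      []  = [] , [] , refl
  reflect⁺ (u ∷ V) T⊆ with ⊆-++⁻ [ u ] T⊆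
  ... | T₁ , T₂ , refl , t₁ , t₂ with flip⁺ u t₁ | reflect⁺ V t₂
  ... | S₁ , s₁ , eq₁ | S₂ , s₂ , eq₂ = S₁ ++ S₂ , ++⁺ s₁ s₂ , ≈-++ T₁ T₂ S₁ S₂ eq₁ eq₂

  reflect⁻ : ∀ V {S} → S ⊆ map ∣_∣ₚ V → ∃ λ T → T ⊆ V × total T + Excess V ≈ sum S
  reflect⁻ []      []  = [] , [] , refl
  reflect⁻ (u ∷ V) S⊆ with ⊆-++⁻ [ ∣ u ∣ₚ ] S⊆
  ... | S₁ , S₂ , refl , s₁ , s₂ with flip⁻ u s₁ | reflect⁻ V s₂
  ... | T₁ , t₁ , eq₁ | T₂ , t₂ , eq₂ = T₁ ++ T₂ , ++⁺ t₁ t₂ , ≈-++ T₁ T₂ S₁ S₂ eq₁ eq₂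

  Covers : List ℕ → Set
  Covers xs = ∀ r → ∃ λ S → S ⊆ xs × sum S ≈ r

  -- Σ(V) = ℤ_p iff the subset sums of |V| meet every residue class: by reflection,
  -- Σ(V) + Excess V is the set of residues of those subset sums.
  full⇔covers : ∀ V → ΣFull V ⇔ Covers (map ∣_∣ₚ V)
  full⇔covers V = mk⇔ to from
    where
    to : ΣFull V → Covers (map ∣_∣ₚ V)
    to full r with shift-onto (Excess V) r
    ... | x , x≈r with full x
    ...   | T , T⊆ , refl with reflect⁺ V T⊆
    ...     | S , S⊆ , T≈S = S , S⊆ , (begin
      sum S % p                          ≡⟨ sym T≈S ⟩
      (total T + Excess V) % p           ≡⟨ +-cong-≈ (sym (sumₚ-≈ T)) refl ⟩
      (toℕ (sumₚ T) + Excess V) % p      ≡⟨ x≈r ⟩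
      r % p                              ∎)
      where open ≡-Reasoning
    from : Covers (map ∣_∣ₚ V) → ΣFull V
    from covers x with covers (toℕ x + Excess V)
    ... | S , S⊆ , S≈ with reflect⁻ V S⊆
    ...   | T , T⊆ , T≈S = T , T⊆ , ≈⇒≡ (sumₚ T) x (begin
      toℕ (sumₚ T) % p  ≡⟨ sumₚ-≈ T ⟩
      total T % p       ≡⟨ +-cancelʳ-≈ (Excess V) (trans T≈S S≈) ⟩
      toℕ x % p         ∎)
      where open ≡-Reasoning

  -- Subset sums of xs never exceed Σ xs, so covering all p residue classes forces
  -- Σ xs ≥ p - 1: otherwise the residue Σ xs + 1 < p is missed.
  covers⇒bound : ∀ xs → Covers xs → p ≤ suc (sum xs)
  covers⇒bound xs covers with p ≤? suc (sum xs)
  ... | yes p≤ = p≤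
  ... | no  p≰ with covers (suc (sum xs))
  ...   | S , S⊆ , S≈ = ⊥-elim (<-irrefl refl (begin
    suc (sum xs)      ≡⟨ sym (m<n⇒m%n≡m (≰⇒> p≰)) ⟩
    suc (sum xs) % p  ≡⟨ sym S≈ ⟩
    sum S % p         ≤⟨ m%n≤m (sum S) p ⟩
    sum S             ≤⟨ sum-⊆ S⊆ ⟩
    sum xs            ∎))
    where open ≤-Reasoning

  bound⇒covers : ∀ {m as} → All (_≤ m) as → p ≤ suc (m + sum as) → Covers (replicate m 1 ++ as)
  bound⇒covers bounded p≤ r with interval bounded (s≤s⁻¹ (≤-trans (m%n<n r p) p≤))
  ... | S , S⊆ , ΣS≡r%p = S , S⊆ , trans (cong (_% p) ΣS≡r%p) (%-≈ r)

  covers⇔bound : ∀ {m as} → All (_≤ m) as → Covers (replicate m 1 ++ as) ⇔ (p ≤ suc (m + sum as))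
  covers⇔bound {m} {as} bounded = mk⇔
    (λ covers → subst (λ s → p ≤ suc s) (sum-ones-++ m as) (covers⇒bound _ covers))
    (bound⇒covers bounded)

-- For p > 1 we have |1| = 1, so |{1^m} ∪ U| = {1^m} ∪ |U|.
∣onesWith∣ : ∀ {p} .{{_ : NonZero p}} → 1 < p → ∀ m U →
             map ∣_∣ₚ (onesWith m U) ≡ replicate m 1 ++ map ∣_∣ₚ U
∣onesWith∣ {p} 1<p m U = begin
  map ∣_∣ₚ (replicate m oneₚ ++ U)                ≡⟨ map-++ ∣_∣ₚ (replicate m oneₚ) U ⟩
  map ∣_∣ₚ (replicate m oneₚ) ++ map ∣_∣ₚ U       ≡⟨ cong (_++ map ∣_∣ₚ U) (map-replicate ∣_∣ₚ m oneₚ) ⟩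
  replicate m ∣ oneₚ ∣ₚ ++ map ∣_∣ₚ U             ≡⟨ cong (λ a → replicate m a ++ map ∣_∣ₚ U) ∣one∣ ⟩
  replicate m 1 ++ map ∣_∣ₚ U                     ∎
  where
  open ≡-Reasoning
  one≡1 : toℕ (oneₚ {p}) ≡ 1
  one≡1 = trans (toℕ-fromℕ< (m%n<n 1 p)) (m<n⇒m%n≡m 1<p)
  ∣one∣ : ∣ oneₚ {p} ∣ₚ ≡ 1
  ∣one∣ = trans (cong (λ a → a ⊓ (p ∸ a)) one≡1) (m≤n⇒m⊓n≡m (m+n≤o⇒m≤o∸n 1 1<p))

threshold : ∀ p m s → (p ≤ suc (m + s)) ⇔ (p ∸ m ∸ 1 ≤ s)
threshold p m s = mk⇔ to from
  where
  open ≤-Reasoning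
  shifted : p ∸ m ∸ 1 ≡ p ∸ (m + 1)
  shifted = ∸-+-assoc p m 1
  regroup : m + 1 + s ≡ suc (m + s)
  regroup = trans (+-assoc m 1 s) (+-suc m s)
  to : p ≤ suc (m + s) → p ∸ m ∸ 1 ≤ s
  to p≤ rewrite shifted = m≤n+o⇒m∸n≤o p (m + 1) (subst (p ≤_) (sym regroup) p≤)
  from : p ∸ m ∸ 1 ≤ s → p ≤ suc (m + s)
  from ≤s rewrite shifted = begin
    p                        ≤⟨ m≤n+m∸n p (m + 1) ⟩
    m + 1 + (p ∸ (m + 1))    ≤⟨ +-monoʳ-≤ (m + 1) ≤s ⟩
    m + 1 + s                ≡⟨ regroup ⟩
    suc (m + s)              ∎

lemma20 : (p : ℕ) .{{_ : NonZero p}} → Prime p → (m : ℕ) →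
          (U : List (Fin p)) → Unique U → All (λ u → ∣ u ∣ₚ ≤ m) U →
          ΣFull (onesWith m U) ⇔ (p ∸ m ∸ 1 ≤ sum (map ∣_∣ₚ U))
lemma20 p pr m U _ bounded =
  ⇔.trans reflection (⇔.trans (covers⇔bound (All.map⁺ bounded)) (threshold p m (sum (map ∣_∣ₚ U))))
  where
  open Residues p
  1<p : 1 < p
  1<p = nonTrivial⇒n>1 p {{prime⇒nonTrivial pr}}
  reflection : ΣFull (onesWith m U) ⇔ Covers (replicate m 1 ++ map ∣_∣ₚ U)
  reflection = subst (λ xs → ΣFull (onesWith m U) ⇔ Covers xs) (∣onesWith∣ 1<p m U)
                     (full⇔covers (onesWith m U))
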